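{- Let $\mathbf M_1=(S,\mathcal I_1)$, $\mathbf M_2=(S,\mathcal I_2)$ be matroids, $I$ an inclusion-wise maximal common independent set, $e\in I$, and $f_1,f_2$ two distinct in-neighbors of $e$ in $D(I)$. Then $(I\setminus\{e\})\cup\{f_1,f_2\}$ is dependent in $\mathbf M_2$.
   Context: $D(I)$ is the digraph on $S\cup\{s,t\}$ with arcs: $(e',f')$ for $e'\in I$, $f'\in S\setminus I$ with $I\cup\{f'\}\notin\mathcal I_1$ and $(I\cup\{f'\})\setminus\{e'\}\in\mathcal I_1$; $(f',e')$ for $e'\in I$, $f'\in S\setminus I$ with $I\cup\{f'\}\notin\mathcal I_2$ and $(I\cup\{f'\})\setminus\{e'\}\in\mathcal I_2$; $(s,f')$ for $f'\in S\setminus I$ with $I\cup\{f'\}\in\mathcal I_1$; $(f',t)$ for $f'\in S\setminus I$ with $I\cup\{f'\}\in\mathcal I_2$. -}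

module Defs where

open import Data.Nat using (ℕ; _<_)
open import Data.Fin using (Fin)
open import Data.Fin.Subset using (Subset; ⊥; ⁅_⁆; _∈_; _∉_; _⊆_; _∪_; _-_; ∣_∣)
open import Data.Product using (∃; _×_)
open import Relation.Nullary using (¬_)
open import Relation.Binary.PropositionalEquality using (_≡_)

record Matroid (n : ℕ) : Set₁ where
  field
    Indep    : Subset n → Set
    indep-∅  : Indep ⊥
    indep-⊆  : ∀ {A B} → A ⊆ B → Indep B → Indep A
    augment  : ∀ {A B} → Indep A → Indep B → ∣ A ∣ < ∣ B ∣ →
               ∃ λ x → x ∈ B × x ∉ A × Indep (A ∪ ⁅ x ⁆)
open Matroid public

CommonIndep : ∀ {n} → Matroid n → Matroid n → Subset n → Set
CommonIndep M₁ M₂ A = Indep M₁ A × Indep M₂ A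

MaxCommonIndep : ∀ {n} → Matroid n → Matroid n → Subset n → Set
MaxCommonIndep M₁ M₂ I =
  CommonIndep M₁ M₂ I × (∀ J → I ⊆ J → CommonIndep M₁ M₂ J → J ≡ I)

data Vertex (n : ℕ) : Set where
  el : Fin n → Vertex n
  s  : Vertex n
  t  : Vertex n

data Arc {n} (M₁ M₂ : Matroid n) (I : Subset n) : Vertex n → Vertex n → Set where
  arc₁ : ∀ {e f} → e ∈ I → f ∉ I → ¬ Indep M₁ (I ∪ ⁅ f ⁆) →
         Indep M₁ ((I ∪ ⁅ f ⁆) - e) → Arc M₁ M₂ I (el e) (el f)
  arc₂ : ∀ {e f} → e ∈ I → f ∉ I → ¬ Indep M₂ (I ∪ ⁅ f ⁆) →
         Indep M₂ ((I ∪ ⁅ f ⁆) - e) → Arc M₁ M₂ I (el f) (el e)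
  arcs : ∀ {f} → f ∉ I → Indep M₁ (I ∪ ⁅ f ⁆) → Arc M₁ M₂ I s (el f)
  arct : ∀ {f} → f ∉ I → Indep M₂ (I ∪ ⁅ f ⁆) → Arc M₁ M₂ I (el f) t

{-# OPTIONS --safe #-}
module Submission where

-- Removing e from I and adding two new elements f₁, f₂ gives a set at least one
-- larger than I. Were it independent in M₂, augmentation would extend I by
-- one of its elements outside I, i.e. by f₁ or f₂; but f ↦ e being an arc
-- of D(I) entering I means exactly that I + f is M₂-dependent.

open import Defs
open import Data.Nat using (suc; _≤_; _<_; s≤s)
open import Data.Nat.Properties using (≤-refl; n≤1+n; module ≤-Reasoning)
open import Data.Fin using (Fin; zero; suc)
open import Data.Fin.Subset using (Subset; _∈_; _∉_; _∪_; _-_; ⁅_⁆; ∣_∣; _⊂_; inside; outside)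
open import Data.Fin.Subset.Properties
  using (p─⊥≡p; p─q⊆p; p⊆p∪q; x∈p∪q⁺; x∈p∪q⁻; x∈⁅x⁆; x∈⁅y⁆⇒x≡y; ∪-assoc; p⊂q⇒∣p∣<∣q∣)
open import Data.Vec using (_∷_)
open import Data.Product using (_×_; _,_)
open import Data.Sum using (inj₁; inj₂)
open import Data.Empty using (⊥-elim)
open import Relation.Nullary using (¬_)
open import Relation.Binary.PropositionalEquality using (_≢_; sym; subst)

∣p∣≤1+∣p-x∣ : ∀ {n} (p : Subset n) (x : Fin n) → ∣ p ∣ ≤ suc ∣ p - x ∣
∣p∣≤1+∣p-x∣ (outside ∷ p) zero    = subst (λ q → ∣ p ∣ ≤ suc ∣ q ∣) (sym (p─⊥≡p p)) (n≤1+n ∣ p ∣)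
∣p∣≤1+∣p-x∣ (inside  ∷ p) zero    = subst (λ q → suc ∣ p ∣ ≤ suc ∣ q ∣) (sym (p─⊥≡p p)) ≤-refl
∣p∣≤1+∣p-x∣ (outside ∷ p) (suc x) = ∣p∣≤1+∣p-x∣ p x
∣p∣≤1+∣p-x∣ (inside  ∷ p) (suc x) = s≤s (∣p∣≤1+∣p-x∣ p x)

x∉p⇒p⊂p∪⁅x⁆ : ∀ {n} {p : Subset n} {x : Fin n} → x ∉ p → p ⊂ p ∪ ⁅ x ⁆
x∉p⇒p⊂p∪⁅x⁆ {x = x} x∉p = p⊆p∪q ⁅ x ⁆ , x , x∈p∪q⁺ (inj₂ (x∈⁅x⁆ x)) , x∉p

∣p∣<∣p-x∪⁅y⁆∪⁅z⁆∣ : ∀ {n} (p : Subset n) (x : Fin n) {y z : Fin n} →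
                    y ∉ p → z ∉ p → y ≢ z → ∣ p ∣ < ∣ (p - x) ∪ ⁅ y ⁆ ∪ ⁅ z ⁆ ∣
∣p∣<∣p-x∪⁅y⁆∪⁅z⁆∣ p x {y} {z} y∉p z∉p y≢z
  rewrite sym (∪-assoc (p - x) ⁅ y ⁆ ⁅ z ⁆) = begin-strict
    ∣ p ∣                           ≤⟨ ∣p∣≤1+∣p-x∣ p x ⟩
    suc ∣ p - x ∣                   ≤⟨ p⊂q⇒∣p∣<∣q∣ (x∉p⇒p⊂p∪⁅x⁆ y∉p-x) ⟩
    ∣ (p - x) ∪ ⁅ y ⁆ ∣             <⟨ p⊂q⇒∣p∣<∣q∣ (x∉p⇒p⊂p∪⁅x⁆ z∉p-x∪⁅y⁆) ⟩
    ∣ ((p - x) ∪ ⁅ y ⁆) ∪ ⁅ z ⁆ ∣  ∎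
  where
  open ≤-Reasoning
  y∉p-x : y ∉ p - x
  y∉p-x y∈p-x = y∉p (p─q⊆p p ⁅ x ⁆ y∈p-x)
  z∉p-x∪⁅y⁆ : z ∉ (p - x) ∪ ⁅ y ⁆
  z∉p-x∪⁅y⁆ z∈ with x∈p∪q⁻ (p - x) ⁅ y ⁆ z∈
  ... | inj₁ z∈p-x = z∉p (p─q⊆p p ⁅ x ⁆ z∈p-x)
  ... | inj₂ z∈⁅y⁆ = y≢z (sym (x∈⁅y⁆⇒x≡y y z∈⁅y⁆))

dependent-double-exchange : ∀ {n} (M : Matroid n) {I : Subset n} (e : Fin n) {f₁ f₂ : Fin n} →
                            Indep M I → f₁ ≢ f₂ →
                            f₁ ∉ I → ¬ Indep M (I ∪ ⁅ f₁ ⁆) →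
                            f₂ ∉ I → ¬ Indep M (I ∪ ⁅ f₂ ⁆) →
                            ¬ Indep M ((I - e) ∪ ⁅ f₁ ⁆ ∪ ⁅ f₂ ⁆)
dependent-double-exchange M {I} e {f₁} {f₂} indI f₁≢f₂ f₁∉I dep₁ f₂∉I dep₂ indJ
  with augment M indI indJ (∣p∣<∣p-x∪⁅y⁆∪⁅z⁆∣ I e f₁∉I f₂∉I f₁≢f₂)
... | x , x∈J , x∉I , indI+x with x∈p∪q⁻ (I - e) (⁅ f₁ ⁆ ∪ ⁅ f₂ ⁆) x∈J
... | inj₁ x∈I-e = x∉I (p─q⊆p I ⁅ e ⁆ x∈I-e)
... | inj₂ x∈⁅f₁,f₂⁆ with x∈p∪q⁻ ⁅ f₁ ⁆ ⁅ f₂ ⁆ x∈⁅f₁,f₂⁆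
...   | inj₁ x∈⁅f₁⁆ = dep₁ (subst (λ y → Indep M (I ∪ ⁅ y ⁆)) (x∈⁅y⁆⇒x≡y f₁ x∈⁅f₁⁆) indI+x)
...   | inj₂ x∈⁅f₂⁆ = dep₂ (subst (λ y → Indep M (I ∪ ⁅ y ⁆)) (x∈⁅y⁆⇒x≡y f₂ x∈⁅f₂⁆) indI+x)

arc-into-I⇒∉×¬Indep₂ : ∀ {n} {M₁ M₂ : Matroid n} {I : Subset n} {f e : Fin n} →
                        e ∈ I → Arc M₁ M₂ I (el f) (el e) →
                        f ∉ I × ¬ Indep M₂ (I ∪ ⁅ f ⁆)
arc-into-I⇒∉×¬Indep₂ e∈I (arc₁ _ e∉I _ _)  = ⊥-elim (e∉I e∈I)
arc-into-I⇒∉×¬Indep₂ e∈I (arc₂ _ f∉I dep _) = f∉I , dep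

lemma6 : ∀ {n} (M₁ M₂ : Matroid n) (I : Subset n) → MaxCommonIndep M₁ M₂ I →
         (e f₁ f₂ : Fin n) → e ∈ I → f₁ ≢ f₂ →
         Arc M₁ M₂ I (el f₁) (el e) → Arc M₁ M₂ I (el f₂) (el e) →
         ¬ Indep M₂ ((I - e) ∪ ⁅ f₁ ⁆ ∪ ⁅ f₂ ⁆)
lemma6 M₁ M₂ I ((_ , indI) , _) e f₁ f₂ e∈I f₁≢f₂ f₁→e f₂→e
  with arc-into-I⇒∉×¬Indep₂ e∈I f₁→e | arc-into-I⇒∉×¬Indep₂ e∈I f₂→e
... | f₁∉I , dep₁ | f₂∉I , dep₂ =
  dependent-double-exchange M₂ e indI f₁≢f₂ f₁∉I dep₁ f₂∉I dep₂
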